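{- Let $q=3^{2h+1}$ with $h\ge 0$ an integer, let $\alpha=\sqrt{3q}=3^{h+1}$, and let $a\in GF(q)$, $a\neq 0$. Suppose $\alpha>3$. Then the polynomial $f_a(x):=x^{2\alpha+3}+(a x)^{\alpha} - a^2 x$ is indecomposable.
   Context: A polynomial is indecomposable if it cannot be written as a composition $g(h(x))$ of two polynomials (with coefficients in the field) each of degree lower than its own degree. -}

module Defs where

open import Level using (0ℓ)
open import Algebra.Bundles using (CommutativeRing)
open import Data.Nat using (ℕ; zero; suc; _<_) renaming (_+_ to _+ℕ_)
open import Data.Fin using (Fin)
open import Data.List using (List; []; _∷_; replicate; _++_; foldr)
open import Data.Product using (Σ; _×_; _,_)
open import Relation.Nullary using (¬_; Dec)
open import Relation.Binary.PropositionalEquality as ≡ using ()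
open import Function.Bundles using (Bijection)

record IsField (R : CommutativeRing 0ℓ 0ℓ) : Set where
  open CommutativeRing R
  field
    1≉0     : ¬ (1# ≈ 0#)
    _≟_     : ∀ x y → Dec (x ≈ y)
    inverse : ∀ x → ¬ (x ≈ 0#) → Σ Carrier (λ y → x * y ≈ 1#)

HasCardinality : (R : CommutativeRing 0ℓ 0ℓ) → ℕ → Set
HasCardinality R q = Bijection (≡.setoid (Fin q)) (CommutativeRing.setoid R)

-- Polynomials over R: coefficient lists, lowest degree first.
module Poly (R : CommutativeRing 0ℓ 0ℓ) where
  open CommutativeRing R

  P : Set
  P = List Carrier

  coeff : P → ℕ → Carrier
  coeff []       _       = 0#
  coeff (c ∷ cs) zero    = c
  coeff (c ∷ cs) (suc n) = coeff cs n

  -- equality of polynomials (trailing zeros irrelevant)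
  _≋_ : P → P → Set
  p ≋ r = ∀ n → coeff p n ≈ coeff r n

  _⊕_ : P → P → P
  []       ⊕ r        = r
  (c ∷ cs) ⊕ []       = c ∷ cs
  (c ∷ cs) ⊕ (d ∷ ds) = (c + d) ∷ (cs ⊕ ds)

  scale : Carrier → P → P
  scale a []       = []
  scale a (c ∷ cs) = (a * c) ∷ scale a cs

  _⊛_ : P → P → P
  []       ⊛ r = []
  (c ∷ cs) ⊛ r = scale c r ⊕ (0# ∷ (cs ⊛ r))

  -- composition g ∘ h, i.e. g(h(x)), by Horner's scheme
  compose : P → P → P
  compose g h = foldr (λ c acc → (c ∷ []) ⊕ (h ⊛ acc)) [] g

  monomial : Carrier → ℕ → P
  monomial c n = replicate n 0# ++ (c ∷ [])

  HasDegree : P → ℕ → Set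
  HasDegree p d = ¬ (coeff p d ≈ 0#) × (∀ n → d < n → coeff p n ≈ 0#)

  Indecomposable : P → Set
  Indecomposable f =
    ∀ d → HasDegree f d →
    ∀ g h dg dh → HasDegree g dg → HasDegree h dh → compose g h ≋ f →
    ¬ (dg < d × dh < d)

  pow : Carrier → ℕ → Carrier
  pow a zero    = 1#
  pow a (suc n) = a * pow a n

  fa : ℕ → Carrier → P
  fa α a = monomial 1# (α +ℕ α +ℕ 3) ⊕ (monomial (pow a α) α ⊕ monomial (- (a * a)) 1)

-- A field of order 3^(2h+1) has characteristic 3, since translation by 1 permutes it. As 3 divides
-- both α and 2α + 3, the formal derivative of f_a is the nonzero constant -a². If f_a = g ∘ h, the
-- chain rule ∂f_a = (∂g ∘ h) · ∂h makes ∂g and ∂h constants, and in characteristic 3 a polynomial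
-- of degree at least 2 with constant derivative has degree divisible by 3. A decomposition with
-- deg g, deg h < deg f_a would thus give 9 ∣ deg g · deg h = 2α + 3, impossible as α > 3 forces 9 ∣ α.
module Submission where

open import Level using (0ℓ)
open import Algebra.Bundles using (CommutativeRing; CommutativeMonoid)
open import Data.Nat as ℕ using (ℕ; zero; suc; _≤_; _<_; z≤n; s≤s)
import Data.Nat.Properties as ℕ
open import Data.Nat.Divisibility
  using (_∣_; divides; ∣-refl; ∣⇒≤; ∣m+n∣m⇒∣n; ∣m∣n⇒∣m+n; m∣m*n; *-pres-∣; m%n≡0⇒n∣m)
open import Data.Nat.DivMod using (_%_; _/_; m≡m%n+[m/n]*n; m%n<n)
open import Data.Fin using (Fin)
open import Data.List using ([]; _∷_)
open import Data.Product using (∃; _×_; _,_; proj₁; proj₂)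
open import Data.Sum using (_⊎_; inj₁; inj₂)
open import Data.Empty using (⊥-elim)
open import Relation.Nullary using (¬_; yes; no)
open import Relation.Binary.Definitions using (tri<; tri≈; tri>)
import Relation.Binary.PropositionalEquality as ≡
open import Function.Bundles using (Inverse)
open import Function.Properties.Bijection using (Bijection⇒Inverse)
open import Data.Fin.Permutation using (permutation)
open import Defs

nontrivial-factors : ∀ {m n d} → m ℕ.* n ≡.≡ d → m < d → n < d → 2 ≤ m × 2 ≤ n
nontrivial-factors {0} ≡.refl ()
nontrivial-factors {1} {n} ≡.refl _ n<n+0 =
  ⊥-elim (ℕ.<-irrefl (≡.sym (ℕ.+-identityʳ n)) n<n+0)
nontrivial-factors {m} {0} m*0≡d _ 0<d =
  ⊥-elim (ℕ.<-irrefl (≡.trans (≡.sym (ℕ.*-zeroʳ m)) m*0≡d) 0<d)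
nontrivial-factors {m} {1} m*1≡d m<d _ =
  ⊥-elim (ℕ.<-irrefl (≡.trans (≡.sym (ℕ.*-identityʳ m)) m*1≡d) m<d)
nontrivial-factors {suc (suc m)} {suc (suc n)} _ _ _ = s≤s (s≤s z≤n) , s≤s (s≤s z≤n)

module Characteristic (R : CommutativeRing 0ℓ 0ℓ) where
  open CommutativeRing R hiding (zero)
  import Algebra.Properties.Semiring.Mult semiring as Mult
  open import Algebra.Properties.CommutativeMonoid.Sum +-commutativeMonoid
    using (sum; sum-permute; sum-cong-≋; ∑-distrib-+; sum-replicate)
  open import Relation.Binary.Reasoning.Setoid setoid

  fromℕ : ℕ → Carrier
  fromℕ n = n Mult.× 1#

  fromℕ-+ : ∀ m n → fromℕ (m ℕ.+ n) ≈ fromℕ m + fromℕ n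
  fromℕ-+ m n = Mult.×-homo-+ 1# m n

  fromℕ-* : ∀ m n → fromℕ (m ℕ.* n) ≈ fromℕ m * fromℕ n
  fromℕ-* = Mult.×1-homo-*

  -- translation by 1 permutes the ring, so  Σ x = Σ (x + 1) = Σ x + q · 1
  cardinality⇒fromℕ≈0 : ∀ {q} → HasCardinality R q → fromℕ q ≈ 0#
  cardinality⇒fromℕ≈0 {q} card = +-identityʳ-unique (sum to) (fromℕ q) (begin
    sum to + fromℕ q                  ≈⟨ +-congˡ (sum-replicate q) ⟨
    sum to + sum {q} (λ _ → 1#)       ≈⟨ ∑-distrib-+ to (λ _ → 1#) ⟨
    sum {q} (λ i → to i + 1#)         ≈⟨ sum-cong-≋ {q} (λ i → to-from (to i + 1#)) ⟨
    sum {q} (λ i → to (translate 1# i))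
      ≈⟨ sum-permute to (permutation (translate 1#) (translate (- 1#))
           (translate-cancel (-‿inverseˡ 1#)) (translate-cancel (-‿inverseʳ 1#))) ⟨
    sum to                            ∎)
    where
    open Inverse (Bijection⇒Inverse card)
    open import Algebra.Properties.Ring ring using (+-identityʳ-unique)

    to-from : ∀ x → to (from x) ≈ x
    to-from x = inverseˡ ≡.refl

    from-to : ∀ i → from (to i) ≡.≡ i
    from-to i = inverseʳ refl

    translate : Carrier → Fin q → Fin q
    translate c i = from (to i + c)

    translate-cancel : ∀ {c d} → d + c ≈ 0# → ∀ i → translate c (translate d i) ≡.≡ i
    translate-cancel {c} {d} d+c≈0 i = ≡.trans (from-cong (begin
      to (from (to i + d)) + c    ≈⟨ +-congʳ (to-from (to i + d)) ⟩
      (to i + d) + c              ≈⟨ +-assoc _ _ _ ⟩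
      to i + (d + c)              ≈⟨ +-congˡ d+c≈0 ⟩
      to i + 0#                   ≈⟨ +-identityʳ (to i) ⟩
      to i                        ∎)) (from-to i)

module Polynomials (R : CommutativeRing 0ℓ 0ℓ) where
  open CommutativeRing R hiding (zero)
  open Poly R
  open Characteristic R public using (fromℕ)
  import Algebra.Properties.CommutativeSemigroup as CommSemigroupProperties

  infix 4 _≐_
  -- _≋_ packed in a record, so that both polynomials can be inferred from an equation
  record _≐_ (p q : P) : Set where
    constructor mk≐
    field coeff-≈ : p ≋ q
  open _≐_ public

  ≐-refl : ∀ {p} → p ≐ p
  ≐-refl = mk≐ λ n → refl

  ≐-sym : ∀ {p q} → p ≐ q → q ≐ p
  ≐-sym (mk≐ e) = mk≐ λ n → sym (e n)

  ≐-trans : ∀ {p q r} → p ≐ q → q ≐ r → p ≐ r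
  ≐-trans (mk≐ e) (mk≐ f) = mk≐ λ n → trans (e n) (f n)

  ∷-cong : ∀ {x y p q} → x ≈ y → p ≐ q → (x ∷ p) ≐ (y ∷ q)
  ∷-cong x≈y (mk≐ e) = mk≐ λ { zero → x≈y ; (suc n) → e n }

  ∷-injectiveʳ : ∀ {x y p q} → (x ∷ p) ≐ (y ∷ q) → p ≐ q
  ∷-injectiveʳ (mk≐ e) = mk≐ λ n → e (suc n)

  ∷≐[] : ∀ {x p} → x ≈ 0# → p ≐ [] → (x ∷ p) ≐ []
  ∷≐[] x≈0 (mk≐ e) = mk≐ λ { zero → x≈0 ; (suc n) → e n }

  ∷≐[]⇒≈0 : ∀ {x p} → (x ∷ p) ≐ [] → x ≈ 0#
  ∷≐[]⇒≈0 (mk≐ e) = e zero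

  ∷≐[]⇒≐[] : ∀ {x p} → (x ∷ p) ≐ [] → p ≐ []
  ∷≐[]⇒≐[] (mk≐ e) = mk≐ λ n → e (suc n)

  coeff-⊕ : ∀ p q n → coeff (p ⊕ q) n ≈ coeff p n + coeff q n
  coeff-⊕ []       q        n       = sym (+-identityˡ _)
  coeff-⊕ (c ∷ cs) []       n       = sym (+-identityʳ _)
  coeff-⊕ (c ∷ cs) (d ∷ ds) zero    = refl
  coeff-⊕ (c ∷ cs) (d ∷ ds) (suc n) = coeff-⊕ cs ds n

  coeff-scale : ∀ a p n → coeff (scale a p) n ≈ a * coeff p n
  coeff-scale a []       n       = sym (zeroʳ a)
  coeff-scale a (c ∷ cs) zero    = refl
  coeff-scale a (c ∷ cs) (suc n) = coeff-scale a cs n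

  ⊕-commutativeMonoid : CommutativeMonoid 0ℓ 0ℓ
  ⊕-commutativeMonoid = record
    { Carrier = P ; _≈_ = _≐_ ; _∙_ = _⊕_ ; ε = []
    ; isCommutativeMonoid = record
      { isMonoid = record
        { isSemigroup = record
          { isMagma = record
            { isEquivalence = record { refl = ≐-refl ; sym = ≐-sym ; trans = ≐-trans }
            ; ∙-cong = ⊕-cong }
          ; assoc = ⊕-assoc }
        ; identity = (λ p → ≐-refl) , ⊕-identityʳ }
      ; comm = ⊕-comm } }
    where
    ⊕-cong : ∀ {p p′ q q′} → p ≐ p′ → q ≐ q′ → (p ⊕ q) ≐ (p′ ⊕ q′)
    ⊕-cong {p} {p′} {q} {q′} (mk≐ e) (mk≐ f) =
      mk≐ λ n → trans (coeff-⊕ p q n) (trans (+-cong (e n) (f n)) (sym (coeff-⊕ p′ q′ n)))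

    ⊕-assoc : ∀ p q r → ((p ⊕ q) ⊕ r) ≐ (p ⊕ (q ⊕ r))
    ⊕-assoc p q r = mk≐ λ n → begin
      coeff ((p ⊕ q) ⊕ r) n                  ≈⟨ coeff-⊕ (p ⊕ q) r n ⟩
      coeff (p ⊕ q) n + coeff r n            ≈⟨ +-congʳ (coeff-⊕ p q n) ⟩
      (coeff p n + coeff q n) + coeff r n    ≈⟨ +-assoc _ _ _ ⟩
      coeff p n + (coeff q n + coeff r n)    ≈⟨ +-congˡ (coeff-⊕ q r n) ⟨
      coeff p n + coeff (q ⊕ r) n            ≈⟨ coeff-⊕ p (q ⊕ r) n ⟨
      coeff (p ⊕ (q ⊕ r)) n                  ∎
      where open import Relation.Binary.Reasoning.Setoid setoid

    ⊕-identityʳ : ∀ p → (p ⊕ []) ≐ p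
    ⊕-identityʳ []      = ≐-refl
    ⊕-identityʳ (x ∷ p) = ≐-refl

    ⊕-comm : ∀ p q → (p ⊕ q) ≐ (q ⊕ p)
    ⊕-comm p q = mk≐ λ n → trans (coeff-⊕ p q n) (trans (+-comm _ _) (sym (coeff-⊕ q p n)))

  open CommutativeMonoid ⊕-commutativeMonoid public using ()
    renaming (∙-cong to ⊕-cong; assoc to ⊕-assoc; comm to ⊕-comm; identityʳ to ⊕-identityʳ;
              setoid to ≐-setoid)
  open CommSemigroupProperties (CommutativeMonoid.commutativeSemigroup ⊕-commutativeMonoid)
    using () renaming (interchange to ⊕-interchange; x∙yz≈y∙xz to ⊕-leftComm)

  ⊕-congˡ : ∀ p {q q′} → q ≐ q′ → (p ⊕ q) ≐ (p ⊕ q′)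
  ⊕-congˡ p = ⊕-cong (≐-refl {p})

  ⊕-congʳ : ∀ {p p′} q → p ≐ p′ → (p ⊕ q) ≐ (p′ ⊕ q)
  ⊕-congʳ q p≐p′ = ⊕-cong p≐p′ (≐-refl {q})

  ⊕-≐[]ʳ : ∀ p {q} → q ≐ [] → (p ⊕ q) ≐ p
  ⊕-≐[]ʳ p q≐[] = ≐-trans (⊕-congˡ p q≐[]) (⊕-identityʳ p)

  scale-cong : ∀ {a b p q} → a ≈ b → p ≐ q → scale a p ≐ scale b q
  scale-cong {a} {b} {p} {q} a≈b (mk≐ e) =
    mk≐ λ n → trans (coeff-scale a p n) (trans (*-cong a≈b (e n)) (sym (coeff-scale b q n)))

  scale-⊕ : ∀ a p q → scale a (p ⊕ q) ≐ (scale a p ⊕ scale a q)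
  scale-⊕ a p q = mk≐ λ n → begin
    coeff (scale a (p ⊕ q)) n                      ≈⟨ coeff-scale a (p ⊕ q) n ⟩
    a * coeff (p ⊕ q) n                            ≈⟨ *-congˡ (coeff-⊕ p q n) ⟩
    a * (coeff p n + coeff q n)                    ≈⟨ distribˡ _ _ _ ⟩
    a * coeff p n + a * coeff q n                  ≈⟨ +-cong (coeff-scale a p n) (coeff-scale a q n) ⟨
    coeff (scale a p) n + coeff (scale a q) n      ≈⟨ coeff-⊕ (scale a p) (scale a q) n ⟨
    coeff (scale a p ⊕ scale a q) n                ∎
    where open import Relation.Binary.Reasoning.Setoid setoid

  scale-+ : ∀ a b p → scale (a + b) p ≐ (scale a p ⊕ scale b p)
  scale-+ a b p = mk≐ λ n → begin
    coeff (scale (a + b) p) n                      ≈⟨ coeff-scale (a + b) p n ⟩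
    (a + b) * coeff p n                            ≈⟨ distribʳ _ _ _ ⟩
    a * coeff p n + b * coeff p n                  ≈⟨ +-cong (coeff-scale a p n) (coeff-scale b p n) ⟨
    coeff (scale a p) n + coeff (scale b p) n      ≈⟨ coeff-⊕ (scale a p) (scale b p) n ⟨
    coeff (scale a p ⊕ scale b p) n                ∎
    where open import Relation.Binary.Reasoning.Setoid setoid

  scale-* : ∀ a b p → scale a (scale b p) ≐ scale (a * b) p
  scale-* a b p = mk≐ λ n → begin
    coeff (scale a (scale b p)) n                  ≈⟨ coeff-scale a (scale b p) n ⟩
    a * coeff (scale b p) n                        ≈⟨ *-congˡ (coeff-scale b p n) ⟩
    a * (b * coeff p n)                            ≈⟨ *-assoc _ _ _ ⟨
    (a * b) * coeff p n                            ≈⟨ coeff-scale (a * b) p n ⟨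
    coeff (scale (a * b) p) n                      ∎
    where open import Relation.Binary.Reasoning.Setoid setoid

  scale-zeroˡ : ∀ {a} p → a ≈ 0# → scale a p ≐ []
  scale-zeroˡ {a} p a≈0 = mk≐ λ n → trans (coeff-scale a p n) (trans (*-congʳ a≈0) (zeroˡ _))

  open import Relation.Binary.Reasoning.Setoid ≐-setoid

  ⊛-zeroˡ : ∀ {p} r → p ≐ [] → (p ⊛ r) ≐ []
  ⊛-zeroˡ {[]}     r p≐[] = ≐-refl
  ⊛-zeroˡ {c ∷ cs} r p≐[] =
    ⊕-cong (scale-zeroˡ r (∷≐[]⇒≈0 p≐[])) (∷≐[] refl (⊛-zeroˡ r (∷≐[]⇒≐[] p≐[])))

  ⊛-zeroʳ : ∀ p → (p ⊛ []) ≐ []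
  ⊛-zeroʳ []       = ≐-refl
  ⊛-zeroʳ (c ∷ cs) = ∷≐[] refl (⊛-zeroʳ cs)

  ⊛-congʳ : ∀ {p p′} r → p ≐ p′ → (p ⊛ r) ≐ (p′ ⊛ r)
  ⊛-congʳ {[]}     r p≐p′ = ≐-sym (⊛-zeroˡ r (≐-sym p≐p′))
  ⊛-congʳ {c ∷ cs} {[]} r p≐p′ = ⊛-zeroˡ r p≐p′
  ⊛-congʳ {c ∷ cs} {c′ ∷ cs′} r p≐p′ =
    ⊕-cong (scale-cong (coeff-≈ p≐p′ zero) ≐-refl) (∷-cong refl (⊛-congʳ r (∷-injectiveʳ p≐p′)))

  ⊛-congˡ : ∀ p {r r′} → r ≐ r′ → (p ⊛ r) ≐ (p ⊛ r′)
  ⊛-congˡ []       r≐r′ = ≐-refl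
  ⊛-congˡ (c ∷ cs) r≐r′ = ⊕-cong (scale-cong refl r≐r′) (∷-cong refl (⊛-congˡ cs r≐r′))

  0∷-⊕ : ∀ p q → (0# ∷ (p ⊕ q)) ≐ ((0# ∷ p) ⊕ (0# ∷ q))
  0∷-⊕ p q = ∷-cong (sym (+-identityˡ 0#)) ≐-refl

  ⊛-distribʳ : ∀ p q r → ((p ⊕ q) ⊛ r) ≐ ((p ⊛ r) ⊕ (q ⊛ r))
  ⊛-distribʳ []       q        r = ≐-refl
  ⊛-distribʳ (c ∷ cs) []       r = ≐-sym (⊕-identityʳ _)
  ⊛-distribʳ (c ∷ cs) (d ∷ ds) r = begin
    scale (c + d) r ⊕ (0# ∷ ((cs ⊕ ds) ⊛ r))
      ≈⟨ ⊕-cong (scale-+ c d r)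
                (≐-trans (∷-cong refl (⊛-distribʳ cs ds r)) (0∷-⊕ (cs ⊛ r) (ds ⊛ r))) ⟩
    (scale c r ⊕ scale d r) ⊕ ((0# ∷ (cs ⊛ r)) ⊕ (0# ∷ (ds ⊛ r)))
      ≈⟨ ⊕-interchange (scale c r) (scale d r) (0# ∷ (cs ⊛ r)) (0# ∷ (ds ⊛ r)) ⟩
    (scale c r ⊕ (0# ∷ (cs ⊛ r))) ⊕ (scale d r ⊕ (0# ∷ (ds ⊛ r)))  ∎

  ⊛-distribˡ : ∀ p q r → (p ⊛ (q ⊕ r)) ≐ ((p ⊛ q) ⊕ (p ⊛ r))
  ⊛-distribˡ []       q r = ≐-refl
  ⊛-distribˡ (c ∷ cs) q r = begin
    scale c (q ⊕ r) ⊕ (0# ∷ (cs ⊛ (q ⊕ r)))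
      ≈⟨ ⊕-cong (scale-⊕ c q r)
                (≐-trans (∷-cong refl (⊛-distribˡ cs q r)) (0∷-⊕ (cs ⊛ q) (cs ⊛ r))) ⟩
    (scale c q ⊕ scale c r) ⊕ ((0# ∷ (cs ⊛ q)) ⊕ (0# ∷ (cs ⊛ r)))
      ≈⟨ ⊕-interchange (scale c q) (scale c r) (0# ∷ (cs ⊛ q)) (0# ∷ (cs ⊛ r)) ⟩
    (scale c q ⊕ (0# ∷ (cs ⊛ q))) ⊕ (scale c r ⊕ (0# ∷ (cs ⊛ r)))  ∎

  ⊛-constantʳ : ∀ p c → (p ⊛ (c ∷ [])) ≐ scale c p
  ⊛-constantʳ []       c = ≐-refl
  ⊛-constantʳ (d ∷ ds) c = ∷-cong (trans (+-identityʳ _) (*-comm _ _)) (⊛-constantʳ ds c)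

  ⊛-0∷ʳ : ∀ p r → (p ⊛ (0# ∷ r)) ≐ (0# ∷ (p ⊛ r))
  ⊛-0∷ʳ []       r = ≐-sym (∷≐[] refl ≐-refl)
  ⊛-0∷ʳ (c ∷ cs) r = ∷-cong (trans (+-identityʳ _) (zeroʳ _)) (⊕-congˡ (scale c r) (⊛-0∷ʳ cs r))

  ⊛-comm : ∀ p q → (p ⊛ q) ≐ (q ⊛ p)
  ⊛-comm []       q = ≐-sym (⊛-zeroʳ q)
  ⊛-comm (c ∷ cs) q = begin
    scale c q ⊕ (0# ∷ (cs ⊛ q))
      ≈⟨ ⊕-cong (≐-sym (⊛-constantʳ q c)) (∷-cong refl (⊛-comm cs q)) ⟩
    (q ⊛ (c ∷ [])) ⊕ (0# ∷ (q ⊛ cs))        ≈⟨ ⊕-congˡ (q ⊛ (c ∷ [])) (⊛-0∷ʳ q cs) ⟨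
    (q ⊛ (c ∷ [])) ⊕ (q ⊛ (0# ∷ cs))        ≈⟨ ⊛-distribˡ q (c ∷ []) (0# ∷ cs) ⟨
    q ⊛ ((c ∷ []) ⊕ (0# ∷ cs))              ≈⟨ ⊛-congˡ q (∷-cong (+-identityʳ c) ≐-refl) ⟩
    q ⊛ (c ∷ cs)                            ∎

  scale-⊛ : ∀ a p r → (scale a p ⊛ r) ≐ scale a (p ⊛ r)
  scale-⊛ a []       r = ≐-refl
  scale-⊛ a (c ∷ cs) r = begin
    scale (a * c) r ⊕ (0# ∷ (scale a cs ⊛ r))
      ≈⟨ ⊕-cong (≐-sym (scale-* a c r)) (∷-cong (sym (zeroʳ a)) (scale-⊛ a cs r)) ⟩
    scale a (scale c r) ⊕ scale a (0# ∷ (cs ⊛ r))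
      ≈⟨ scale-⊕ a (scale c r) (0# ∷ (cs ⊛ r)) ⟨
    scale a (scale c r ⊕ (0# ∷ (cs ⊛ r)))  ∎

  0∷-⊛ : ∀ p r → ((0# ∷ p) ⊛ r) ≐ (0# ∷ (p ⊛ r))
  0∷-⊛ p r = ⊕-congʳ (0# ∷ (p ⊛ r)) (scale-zeroˡ r refl)

  ⊛-assoc : ∀ p q r → ((p ⊛ q) ⊛ r) ≐ (p ⊛ (q ⊛ r))
  ⊛-assoc []       q r = ≐-refl
  ⊛-assoc (c ∷ cs) q r = begin
    (scale c q ⊕ (0# ∷ (cs ⊛ q))) ⊛ r           ≈⟨ ⊛-distribʳ (scale c q) _ r ⟩
    (scale c q ⊛ r) ⊕ ((0# ∷ (cs ⊛ q)) ⊛ r)     ≈⟨ ⊕-cong (scale-⊛ c q r) (0∷-⊛ (cs ⊛ q) r) ⟩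
    scale c (q ⊛ r) ⊕ (0# ∷ ((cs ⊛ q) ⊛ r))
      ≈⟨ ⊕-congˡ (scale c (q ⊛ r)) (∷-cong refl (⊛-assoc cs q r)) ⟩
    scale c (q ⊛ r) ⊕ (0# ∷ (cs ⊛ (q ⊛ r)))     ∎

  compose-⊕ : ∀ p q h → compose (p ⊕ q) h ≐ (compose p h ⊕ compose q h)
  compose-⊕ []       q        h = ≐-refl
  compose-⊕ (c ∷ cs) []       h = ≐-sym (⊕-identityʳ _)
  compose-⊕ (c ∷ cs) (d ∷ ds) h = begin
    ((c ∷ []) ⊕ (d ∷ [])) ⊕ (h ⊛ compose (cs ⊕ ds) h)
      ≈⟨ ⊕-congˡ ((c ∷ []) ⊕ (d ∷ []))
                 (≐-trans (⊛-congˡ h (compose-⊕ cs ds h)) (⊛-distribˡ h _ _)) ⟩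
    ((c ∷ []) ⊕ (d ∷ [])) ⊕ ((h ⊛ compose cs h) ⊕ (h ⊛ compose ds h))
      ≈⟨ ⊕-interchange (c ∷ []) (d ∷ []) (h ⊛ compose cs h) (h ⊛ compose ds h) ⟩
    ((c ∷ []) ⊕ (h ⊛ compose cs h)) ⊕ ((d ∷ []) ⊕ (h ⊛ compose ds h))  ∎

  compose-zeroˡ : ∀ {p} h → p ≐ [] → compose p h ≐ []
  compose-zeroˡ {[]}     h p≐[] = ≐-refl
  compose-zeroˡ {c ∷ cs} h p≐[] =
    ⊕-cong (∷≐[] (∷≐[]⇒≈0 p≐[]) ≐-refl)
           (≐-trans (⊛-congˡ h (compose-zeroˡ h (∷≐[]⇒≐[] p≐[]))) (⊛-zeroʳ h))

  compose-0∷ : ∀ p h → compose (0# ∷ p) h ≐ (h ⊛ compose p h)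
  compose-0∷ p h = ⊕-congʳ (h ⊛ compose p h) (∷≐[] refl ≐-refl)

  ∂ : P → P
  ∂ []       = []
  ∂ (c ∷ cs) = cs ⊕ (0# ∷ ∂ cs)

  coeff-∂ : ∀ p n → coeff (∂ p) n ≈ fromℕ (suc n) * coeff p (suc n)
  coeff-∂ []       n       = sym (zeroʳ _)
  coeff-∂ (c ∷ cs) zero    =
    trans (coeff-⊕ cs (0# ∷ ∂ cs) zero)
          (trans (+-identityʳ _) (sym (trans (*-congʳ (+-identityʳ 1#)) (*-identityˡ _))))
  coeff-∂ (c ∷ cs) (suc n) =
    trans (coeff-⊕ cs (0# ∷ ∂ cs) (suc n))
          (trans (+-cong (sym (*-identityˡ _)) (coeff-∂ cs n)) (sym (distribʳ _ _ _)))

  ∂-cong : ∀ {p q} → p ≐ q → ∂ p ≐ ∂ q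
  ∂-cong {p} {q} (mk≐ e) =
    mk≐ λ n → trans (coeff-∂ p n) (trans (*-congˡ (e (suc n))) (sym (coeff-∂ q n)))

  ∂-⊕ : ∀ p q → ∂ (p ⊕ q) ≐ (∂ p ⊕ ∂ q)
  ∂-⊕ p q = mk≐ λ n →
    trans (coeff-∂ (p ⊕ q) n)
   (trans (*-congˡ (coeff-⊕ p q (suc n)))
   (trans (distribˡ _ _ _)
          (sym (trans (coeff-⊕ (∂ p) (∂ q) n) (+-cong (coeff-∂ p n) (coeff-∂ q n))))))

  ∂-scale : ∀ a p → ∂ (scale a p) ≐ scale a (∂ p)
  ∂-scale a p = mk≐ λ n →
    trans (coeff-∂ (scale a p) n)
   (trans (*-congˡ (coeff-scale a p (suc n)))
   (trans (x∙yz≈y∙xz _ _ _)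
          (sym (trans (coeff-scale a (∂ p) n) (*-congˡ (coeff-∂ p n))))))
    where open CommSemigroupProperties *-commutativeSemigroup using (x∙yz≈y∙xz)

  ∂-⊛ : ∀ p q → ∂ (p ⊛ q) ≐ ((∂ p ⊛ q) ⊕ (p ⊛ ∂ q))
  ∂-⊛ []       q = ≐-refl
  ∂-⊛ (c ∷ cs) q = begin
    ∂ (scale c q ⊕ (0# ∷ (cs ⊛ q)))          ≈⟨ ∂-⊕ (scale c q) _ ⟩
    ∂ (scale c q) ⊕ (B ⊕ (0# ∷ ∂ (cs ⊛ q)))
      ≈⟨ ⊕-cong (∂-scale c q)
                (⊕-congˡ B (≐-trans (∷-cong refl (∂-⊛ cs q)) (0∷-⊕ (∂ cs ⊛ q) (cs ⊛ ∂ q)))) ⟩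
    A ⊕ (B ⊕ (C ⊕ E))                        ≈⟨ ⊕-congˡ A (⊕-assoc B C E) ⟨
    A ⊕ ((B ⊕ C) ⊕ E)                        ≈⟨ ⊕-leftComm A (B ⊕ C) E ⟩
    (B ⊕ C) ⊕ (A ⊕ E)                        ≈⟨ ⊕-congʳ (A ⊕ E) (⊕-congˡ B (0∷-⊛ (∂ cs) q)) ⟨
    ((cs ⊛ q) ⊕ ((0# ∷ ∂ cs) ⊛ q)) ⊕ (A ⊕ E) ≈⟨ ⊕-congʳ (A ⊕ E) (⊛-distribʳ cs (0# ∷ ∂ cs) q) ⟨
    ((cs ⊕ (0# ∷ ∂ cs)) ⊛ q) ⊕ (A ⊕ E)       ∎
    where
    A = scale c (∂ q)
    B = cs ⊛ q
    C = 0# ∷ (∂ cs ⊛ q)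
    E = 0# ∷ (cs ⊛ ∂ q)

  ∂-compose : ∀ g h → ∂ (compose g h) ≐ (compose (∂ g) h ⊛ ∂ h)
  ∂-compose []       h = ≐-refl
  ∂-compose (c ∷ cs) h = begin
    ∂ ((c ∷ []) ⊕ (h ⊛ G))              ≈⟨ ∂-⊕ (c ∷ []) (h ⊛ G) ⟩
    (0# ∷ []) ⊕ ∂ (h ⊛ G)               ≈⟨ ⊕-cong (∷≐[] refl ≐-refl) (∂-⊛ h G) ⟩
    (∂ h ⊛ G) ⊕ (h ⊛ ∂ G)               ≈⟨ ⊕-cong (⊛-comm (∂ h) G) (⊛-congˡ h (∂-compose cs h)) ⟩
    (G ⊛ ∂ h) ⊕ (h ⊛ (G′ ⊛ ∂ h))        ≈⟨ ⊕-congˡ (G ⊛ ∂ h) (⊛-assoc h G′ (∂ h)) ⟨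
    (G ⊛ ∂ h) ⊕ ((h ⊛ G′) ⊛ ∂ h)        ≈⟨ ⊛-distribʳ G (h ⊛ G′) (∂ h) ⟨
    (G ⊕ (h ⊛ G′)) ⊛ ∂ h                ≈⟨ ⊛-congʳ (∂ h) (⊕-congˡ G (compose-0∷ (∂ cs) h)) ⟨
    (G ⊕ compose (0# ∷ ∂ cs) h) ⊛ ∂ h   ≈⟨ ⊛-congʳ (∂ h) (compose-⊕ cs (0# ∷ ∂ cs) h) ⟨
    compose (cs ⊕ (0# ∷ ∂ cs)) h ⊛ ∂ h  ∎
    where
    G  = compose cs h
    G′ = compose (∂ cs) h

  coeff-monomial-≡ : ∀ c k → coeff (monomial c k) k ≡.≡ c
  coeff-monomial-≡ c zero    = ≡.refl
  coeff-monomial-≡ c (suc k) = coeff-monomial-≡ c k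

  coeff-monomial-≢ : ∀ c k n → n ≡.≢ k → coeff (monomial c k) n ≡.≡ 0#
  coeff-monomial-≢ c zero    zero    n≢k = ⊥-elim (n≢k ≡.refl)
  coeff-monomial-≢ c zero    (suc n) n≢k = ≡.refl
  coeff-monomial-≢ c (suc k) zero    n≢k = ≡.refl
  coeff-monomial-≢ c (suc k) (suc n) n≢k = coeff-monomial-≢ c k n (λ n≡k → n≢k (≡.cong suc n≡k))

  ∂-monomial : ∀ c e → fromℕ e ≈ 0# → ∂ (monomial c e) ≐ []
  ∂-monomial c e e≈0 = mk≐ λ n → trans (coeff-∂ (monomial c e) n) (vanishes n)
    where
    vanishes : ∀ n → fromℕ (suc n) * coeff (monomial c e) (suc n) ≈ 0#
    vanishes n with suc n ℕ.≟ e
    ... | yes ≡.refl = trans (*-congʳ e≈0) (zeroˡ _)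
    ... | no 1+n≢e   = trans (*-congˡ (reflexive (coeff-monomial-≢ c e (suc n) 1+n≢e))) (zeroʳ _)

  DegreeAtMost : P → ℕ → Set
  DegreeAtMost p e = ∀ n → e < n → coeff p n ≈ 0#

  DegreeAtMost-mono : ∀ p {e e′} → e ≤ e′ → DegreeAtMost p e → DegreeAtMost p e′
  DegreeAtMost-mono p e≤e′ p≤e n e′<n = p≤e n (ℕ.≤-<-trans e≤e′ e′<n)

  DegreeAtMost-⊕ : ∀ p q {e} → DegreeAtMost p e → DegreeAtMost q e → DegreeAtMost (p ⊕ q) e
  DegreeAtMost-⊕ p q p≤e q≤e n e<n =
    trans (coeff-⊕ p q n) (trans (+-cong (p≤e n e<n) (q≤e n e<n)) (+-identityʳ 0#))

  DegreeAtMost-scale : ∀ a p {e} → DegreeAtMost p e → DegreeAtMost (scale a p) e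
  DegreeAtMost-scale a p p≤e n e<n = trans (coeff-scale a p n) (trans (*-congˡ (p≤e n e<n)) (zeroʳ a))

  DegreeAtMost-constant : ∀ c → DegreeAtMost (c ∷ []) 0
  DegreeAtMost-constant c (suc n) _ = refl

  DegreeAtMost-monomial : ∀ c k → DegreeAtMost (monomial c k) k
  DegreeAtMost-monomial c k n k<n = reflexive (coeff-monomial-≢ c k n (ℕ.>⇒≢ k<n))

  DegreeAtMost-0⇒∂≐[] : ∀ p → DegreeAtMost p 0 → ∂ p ≐ []
  DegreeAtMost-0⇒∂≐[] p p≤0 =
    mk≐ λ n → trans (coeff-∂ p n) (trans (*-congˡ (p≤0 (suc n) (s≤s z≤n))) (zeroʳ _))

  HasDegree-cong : ∀ {p q d} → p ≐ q → HasDegree p d → HasDegree q d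
  HasDegree-cong {d = d} (mk≐ e) (lead≉0 , p≤d) =
    (λ lead≈0 → lead≉0 (trans (e d) lead≈0)) , λ n d<n → trans (sym (e n)) (p≤d n d<n)

  HasDegree⇒≉[] : ∀ {p d} → HasDegree p d → ¬ p ≐ []
  HasDegree⇒≉[] {d = d} (lead≉0 , _) p≐[] = lead≉0 (coeff-≈ p≐[] d)

  degree-unique : ∀ p {d e} → HasDegree p d → HasDegree p e → d ≡.≡ e
  degree-unique p {d} {e} (lead≉0 , p≤d) (lead′≉0 , p≤e) with ℕ.<-cmp d e
  ... | tri< d<e _ _ = ⊥-elim (lead′≉0 (p≤d e d<e))
  ... | tri≈ _ d≡e _ = d≡e
  ... | tri> _ _ e<d = ⊥-elim (lead≉0 (p≤e d e<d))

  HasDegree-constant : ∀ {c} → ¬ c ≈ 0# → HasDegree (c ∷ []) 0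
  HasDegree-constant {c} c≉0 = c≉0 , DegreeAtMost-constant c

  HasDegree-monomial : ∀ {c} k → ¬ c ≈ 0# → HasDegree (monomial c k) k
  HasDegree-monomial {c} k c≉0 =
      (λ lead≈0 → c≉0 (trans (reflexive (≡.sym (coeff-monomial-≡ c k))) lead≈0))
    , DegreeAtMost-monomial c k

  HasDegree-∷ : ∀ {c p d} → HasDegree p d → HasDegree (c ∷ p) (suc d)
  HasDegree-∷ (lead≉0 , p≤d) = lead≉0 , λ { (suc n) (s≤s d<n) → p≤d n d<n }

  HasDegree-∷⁻ : ∀ {c p d} → HasDegree (c ∷ p) (suc d) → HasDegree p d
  HasDegree-∷⁻ (lead≉0 , p≤d) = lead≉0 , λ n d<n → p≤d (suc n) (s≤s d<n)

  HasDegree-0⇒tail≐[] : ∀ {c p} → HasDegree (c ∷ p) 0 → p ≐ []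
  HasDegree-0⇒tail≐[] (_ , p≤0) = mk≐ λ n → p≤0 (suc n) (s≤s z≤n)

  HasDegree-⊕-lower : ∀ p q {d e} → HasDegree p d → DegreeAtMost q e → e < d → HasDegree (p ⊕ q) d
  HasDegree-⊕-lower p q {d} (lead≉0 , p≤d) q≤e e<d =
    (λ lead≈0 → lead≉0 (trans (sym (+-identityʳ _)) (trans (+-congˡ (sym (q≤e d e<d)))
                         (trans (sym (coeff-⊕ p q d)) lead≈0))))
    , DegreeAtMost-⊕ p q p≤d (DegreeAtMost-mono q (ℕ.<⇒≤ e<d) q≤e)

module PolynomialsOverField (F : CommutativeRing 0ℓ 0ℓ) (isField : IsField F) where
  open CommutativeRing F hiding (zero)
  open IsField isField
  open Poly F
  open Polynomials F
  open Characteristic F using (fromℕ-+; fromℕ-*)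

  x*y≈0⇒y≈0 : ∀ {x y} → ¬ x ≈ 0# → x * y ≈ 0# → y ≈ 0#
  x*y≈0⇒y≈0 {x} {y} x≉0 xy≈0 with inverse x x≉0
  ... | x⁻¹ , xx⁻¹≈1 = begin
    y                ≈⟨ *-identityˡ y ⟨
    1# * y           ≈⟨ *-congʳ (trans (sym xx⁻¹≈1) (*-comm x x⁻¹)) ⟩
    (x⁻¹ * x) * y    ≈⟨ *-assoc _ _ _ ⟩
    x⁻¹ * (x * y)    ≈⟨ *-congˡ xy≈0 ⟩
    x⁻¹ * 0#         ≈⟨ zeroʳ _ ⟩
    0#               ∎
    where open import Relation.Binary.Reasoning.Setoid setoid

  x*y≉0 : ∀ {x y} → ¬ x ≈ 0# → ¬ y ≈ 0# → ¬ x * y ≈ 0#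
  x*y≉0 x≉0 y≉0 xy≈0 = y≉0 (x*y≈0⇒y≈0 x≉0 xy≈0)

  -x*x≉0 : ∀ {x} → ¬ x ≈ 0# → ¬ - (x * x) ≈ 0#
  -x*x≉0 x≉0 -xx≈0 = x*y≉0 x≉0 x≉0 (-‿injective (trans -xx≈0 (sym -0#≈0#)))
    where open import Algebra.Properties.Ring ring using (-‿injective; -0#≈0#)

  fromℕ-^≈0 : ∀ m k → fromℕ (m ℕ.^ k) ≈ 0# → fromℕ m ≈ 0#
  fromℕ-^≈0 m zero    1+0≈0 = ⊥-elim (1≉0 (trans (sym (+-identityʳ 1#)) 1+0≈0))
  fromℕ-^≈0 m (suc k) mᵏ⁺¹≈0 with fromℕ m ≟ 0#
  ... | yes m≈0 = m≈0
  ... | no  m≉0 = fromℕ-^≈0 m k (x*y≈0⇒y≈0 m≉0 (trans (sym (fromℕ-* m (m ℕ.^ k))) mᵏ⁺¹≈0))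

  ≐[]⊎HasDegree : ∀ p → p ≐ [] ⊎ ∃ (HasDegree p)
  ≐[]⊎HasDegree []       = inj₁ ≐-refl
  ≐[]⊎HasDegree (c ∷ cs) with ≐[]⊎HasDegree cs
  ... | inj₂ (d , cs-deg) = inj₂ (suc d , HasDegree-∷ cs-deg)
  ... | inj₁ cs≐[] with c ≟ 0#
  ...   | yes c≈0 = inj₁ (∷≐[] c≈0 cs≐[])
  ...   | no  c≉0 = inj₂ (0 , c≉0 , λ { (suc n) _ → coeff-≈ cs≐[] n })

  HasDegree-scale : ∀ c q {n} → ¬ c ≈ 0# → HasDegree q n → HasDegree (scale c q) n
  HasDegree-scale c q {n} c≉0 (lead≉0 , q≤n) =
      (λ lead≈0 → x*y≉0 c≉0 lead≉0 (trans (sym (coeff-scale c q n)) lead≈0))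
    , DegreeAtMost-scale c q q≤n

  HasDegree-⊛ : ∀ p q {m n} → HasDegree p m → HasDegree q n → HasDegree (p ⊛ q) (m ℕ.+ n)
  HasDegree-⊛ []       q p-deg _ = ⊥-elim (HasDegree⇒≉[] p-deg ≐-refl)
  HasDegree-⊛ (c ∷ cs) q {zero} p-deg q-deg =
    HasDegree-cong (≐-sym (⊕-≐[]ʳ (scale c q) (∷≐[] refl (⊛-zeroˡ q (HasDegree-0⇒tail≐[] p-deg)))))
                   (HasDegree-scale c q (proj₁ p-deg) q-deg)
  HasDegree-⊛ (c ∷ cs) q {suc m} {n} p-deg q-deg =
    HasDegree-cong (⊕-comm (0# ∷ (cs ⊛ q)) (scale c q))
      (HasDegree-⊕-lower (0# ∷ (cs ⊛ q)) (scale c q)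
        (HasDegree-∷ (HasDegree-⊛ cs q (HasDegree-∷⁻ p-deg) q-deg))
        (DegreeAtMost-scale c q (proj₂ q-deg)) (s≤s (ℕ.m≤n+m n m)))

  HasDegree-compose : ∀ g h {dg dh} → HasDegree g dg → HasDegree h (suc dh) →
                      HasDegree (compose g h) (dg ℕ.* suc dh)
  HasDegree-compose []       h g-deg _ = ⊥-elim (HasDegree⇒≉[] g-deg ≐-refl)
  HasDegree-compose (c ∷ cs) h {zero} g-deg h-deg =
    HasDegree-cong
      (≐-sym (⊕-≐[]ʳ (c ∷ [])
        (≐-trans (⊛-congˡ h (compose-zeroˡ h (HasDegree-0⇒tail≐[] g-deg))) (⊛-zeroʳ h))))
      (HasDegree-constant (proj₁ g-deg))
  HasDegree-compose (c ∷ cs) h {suc k} g-deg h-deg =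
    HasDegree-cong (⊕-comm (h ⊛ compose cs h) (c ∷ []))
      (HasDegree-⊕-lower (h ⊛ compose cs h) (c ∷ [])
        (HasDegree-⊛ h (compose cs h) h-deg (HasDegree-compose cs h (HasDegree-∷⁻ g-deg) h-deg))
        (DegreeAtMost-constant c) (s≤s z≤n))

  ∂-constant⇒fromℕ-degree≈0 : ∀ p {m} → HasDegree p m → 2 ≤ m → DegreeAtMost (∂ p) 0 → fromℕ m ≈ 0#
  ∂-constant⇒fromℕ-degree≈0 p {suc (suc m)} (lead≉0 , _) (s≤s (s≤s _)) ∂p≤0 =
    x*y≈0⇒y≈0 lead≉0 (trans (*-comm _ _) (trans (sym (coeff-∂ p (suc m))) (∂p≤0 (suc m) (s≤s z≤n))))

  -- by the chain rule the constant is the product of compose (∂ g) h and ∂ h, so both factors have degree 0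
  ∂-compose-constant : ∀ g h {c dh} → ¬ c ≈ 0# → ∂ (compose g h) ≐ (c ∷ []) → HasDegree h (suc dh) →
                       DegreeAtMost (∂ g) 0 × DegreeAtMost (∂ h) 0
  ∂-compose-constant g h {c} {dh} c≉0 ∂g∘h≐c h-deg = cases (≐[]⊎HasDegree (∂ g)) (≐[]⊎HasDegree (∂ h))
    where
    chain-deg : HasDegree (compose (∂ g) h ⊛ ∂ h) 0
    chain-deg = HasDegree-cong (≐-trans (≐-sym ∂g∘h≐c) (∂-compose g h)) (HasDegree-constant c≉0)

    chain≉[] : ¬ (compose (∂ g) h ⊛ ∂ h) ≐ []
    chain≉[] = HasDegree⇒≉[] chain-deg

    cases : ∂ g ≐ [] ⊎ ∃ (HasDegree (∂ g)) → ∂ h ≐ [] ⊎ ∃ (HasDegree (∂ h)) →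
            DegreeAtMost (∂ g) 0 × DegreeAtMost (∂ h) 0
    cases (inj₁ ∂g≐[]) _ = ⊥-elim (chain≉[] (⊛-congʳ (∂ h) (compose-zeroˡ h ∂g≐[])))
    cases (inj₂ _) (inj₁ ∂h≐[]) =
      ⊥-elim (chain≉[] (≐-trans (⊛-congˡ (compose (∂ g) h) ∂h≐[]) (⊛-zeroʳ (compose (∂ g) h))))
    cases (inj₂ (k , ∂g-deg)) (inj₂ (e , ∂h-deg)) =
        ≡.subst (DegreeAtMost (∂ g)) (ℕ.m*n≡0⇒m≡0 k (suc dh) (ℕ.m+n≡0⇒m≡0 (k ℕ.* suc dh) k*dh+e≡0))
                (proj₂ ∂g-deg)
      , ≡.subst (DegreeAtMost (∂ h)) (ℕ.m+n≡0⇒n≡0 (k ℕ.* suc dh) k*dh+e≡0) (proj₂ ∂h-deg)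
      where
      k*dh+e≡0 : k ℕ.* suc dh ℕ.+ e ≡.≡ 0
      k*dh+e≡0 = degree-unique (compose (∂ g) h ⊛ ∂ h) (HasDegree-⊛ (compose (∂ g) h) (∂ h)
                                 (HasDegree-compose (∂ g) h ∂g-deg h-deg) ∂h-deg) chain-deg

  fa-degree : ∀ α a → 1 < α → HasDegree (fa α a) (α ℕ.+ α ℕ.+ 3)
  fa-degree α a 1<α =
    HasDegree-⊕-lower (monomial 1# (α ℕ.+ α ℕ.+ 3)) (monomial (pow a α) α ⊕ monomial (- (a * a)) 1)
      (HasDegree-monomial (α ℕ.+ α ℕ.+ 3) 1≉0)
      (DegreeAtMost-⊕ (monomial (pow a α) α) (monomial (- (a * a)) 1)
        (DegreeAtMost-monomial (pow a α) α)
        (DegreeAtMost-mono (monomial (- (a * a)) 1) (ℕ.<⇒≤ 1<α) (DegreeAtMost-monomial (- (a * a)) 1)))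
      (ℕ.≤-<-trans (ℕ.m≤m+n α α) (ℕ.m<m+n (α ℕ.+ α) (s≤s z≤n)))

  module Characteristic3 (3≈0 : fromℕ 3 ≈ 0#) where

    3∣⇒fromℕ≈0 : ∀ {k} → 3 ∣ k → fromℕ k ≈ 0#
    3∣⇒fromℕ≈0 (divides q ≡.refl) = trans (fromℕ-* q 3) (trans (*-congˡ 3≈0) (zeroʳ _))

    fromℕ≈0⇒3∣ : ∀ k → fromℕ k ≈ 0# → 3 ∣ k
    fromℕ≈0⇒3∣ k k≈0 = m%n≡0⇒n∣m k 3 (remainder≡0 (m%n<n k 3) (trans (sym fromℕ-k≈fromℕ-k%3) k≈0))
      where
      open import Relation.Binary.Reasoning.Setoid setoid

      fromℕ-k≈fromℕ-k%3 : fromℕ k ≈ fromℕ (k % 3)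
      fromℕ-k≈fromℕ-k%3 = begin
        fromℕ k                                ≡⟨ ≡.cong fromℕ (m≡m%n+[m/n]*n k 3) ⟩
        fromℕ (k % 3 ℕ.+ k / 3 ℕ.* 3)          ≈⟨ fromℕ-+ (k % 3) (k / 3 ℕ.* 3) ⟩
        fromℕ (k % 3) + fromℕ (k / 3 ℕ.* 3)    ≈⟨ +-congˡ (3∣⇒fromℕ≈0 (divides (k / 3) ≡.refl)) ⟩
        fromℕ (k % 3) + 0#                     ≈⟨ +-identityʳ _ ⟩
        fromℕ (k % 3)                          ∎

      remainder≡0 : ∀ {r} → r < 3 → fromℕ r ≈ 0# → r ≡.≡ 0
      remainder≡0 {0} _ _   = ≡.refl
      remainder≡0 {1} _ 1≈0 = ⊥-elim (1≉0 (trans (sym (+-identityʳ 1#)) 1≈0))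
      remainder≡0 {2} _ 2≈0 = ⊥-elim (1≉0 (trans (sym (+-identityʳ 1#)) (trans (+-congˡ (sym 2≈0)) 3≈0)))
      remainder≡0 {suc (suc (suc _))} (s≤s (s≤s (s≤s ())))

    ∂-constant⇒3∣degree : ∀ p {m} → HasDegree p m → 2 ≤ m → DegreeAtMost (∂ p) 0 → 3 ∣ m
    ∂-constant⇒3∣degree p {m} p-deg 2≤m ∂p≤0 =
      fromℕ≈0⇒3∣ m (∂-constant⇒fromℕ-degree≈0 p p-deg 2≤m ∂p≤0)

    ∂-fa : ∀ α a → 3 ∣ α → ∂ (fa α a) ≐ (- (a * a) ∷ [])
    ∂-fa α a 3∣α = begin
      ∂ (M₁ ⊕ (M₂ ⊕ M₃))        ≈⟨ ≐-trans (∂-⊕ M₁ (M₂ ⊕ M₃)) (⊕-congˡ (∂ M₁) (∂-⊕ M₂ M₃)) ⟩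
      ∂ M₁ ⊕ (∂ M₂ ⊕ ∂ M₃)      ≈⟨ ⊕-cong (∂-monomial 1# N (3∣⇒fromℕ≈0 3∣N))
                                          (⊕-congʳ (∂ M₃) (∂-monomial (pow a α) α (3∣⇒fromℕ≈0 3∣α))) ⟩
      ∂ M₃                      ≈⟨ ∷-cong (+-identityʳ _) (∷≐[] refl ≐-refl) ⟩
      - (a * a) ∷ []            ∎
      where
      open import Relation.Binary.Reasoning.Setoid ≐-setoid
      N  = α ℕ.+ α ℕ.+ 3
      M₁ = monomial 1# N
      M₂ = monomial (pow a α) α
      M₃ = monomial (- (a * a)) 1

      3∣N : 3 ∣ N
      3∣N = ∣m∣n⇒∣m+n (∣m∣n⇒∣m+n 3∣α 3∣α) ∣-refl

    ∂-constant⇒indecomposable : ∀ f {N c} → HasDegree f N → ¬ 9 ∣ N → ¬ c ≈ 0# → ∂ f ≐ (c ∷ []) →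
                                Indecomposable f
    ∂-constant⇒indecomposable f {N} {c} f-deg 9∤N c≉0 ∂f≐c d _ g h dg zero g-deg h-deg g∘h≋f _ =
      c≉0 (∷≐[]⇒≈0 (begin
        c ∷ []                  ≈⟨ ∂f≐c ⟨
        ∂ f                     ≈⟨ ∂-cong (mk≐ {compose g h} {f} g∘h≋f) ⟨
        ∂ (compose g h)         ≈⟨ ∂-compose g h ⟩
        compose (∂ g) h ⊛ ∂ h   ≈⟨ ⊛-congˡ (compose (∂ g) h) (DegreeAtMost-0⇒∂≐[] h (proj₂ h-deg)) ⟩
        compose (∂ g) h ⊛ []    ≈⟨ ⊛-zeroʳ (compose (∂ g) h) ⟩
        []                      ∎))
      where open import Relation.Binary.Reasoning.Setoid ≐-setoid
    ∂-constant⇒indecomposable f {N} {c} f-deg 9∤N c≉0 ∂f≐c d f-deg′ g h dg (suc dh) g-deg h-deg g∘h≋f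
                              (dg<d , dh<d) =
      9∤N (≡.subst (9 ∣_) dg*dh≡N
        (*-pres-∣ (∂-constant⇒3∣degree g g-deg (proj₁ 2≤dg×2≤dh) (proj₁ ∂g,∂h≤0))
                  (∂-constant⇒3∣degree h h-deg (proj₂ 2≤dg×2≤dh) (proj₂ ∂g,∂h≤0))))
      where
      g∘h≐f : compose g h ≐ f
      g∘h≐f = mk≐ g∘h≋f

      dg*dh≡N : dg ℕ.* suc dh ≡.≡ N
      dg*dh≡N = degree-unique (compose g h) (HasDegree-compose g h g-deg h-deg)
                              (HasDegree-cong (≐-sym g∘h≐f) f-deg)

      2≤dg×2≤dh : 2 ≤ dg × 2 ≤ suc dh
      2≤dg×2≤dh = nontrivial-factors (≡.trans dg*dh≡N (degree-unique f f-deg f-deg′)) dg<d dh<d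

      ∂g,∂h≤0 : DegreeAtMost (∂ g) 0 × DegreeAtMost (∂ h) 0
      ∂g,∂h≤0 = ∂-compose-constant g h c≉0 (≐-trans (∂-cong g∘h≐f) ∂f≐c) h-deg

open import Data.Nat using (_+_; _*_; _^_)

lemma1 : (F : CommutativeRing 0ℓ 0ℓ) → IsField F →
    (h : ℕ) → HasCardinality F (3 ^ (2 * h + 1)) →
    3 < 3 ^ (h + 1) →
    (a : CommutativeRing.Carrier F) → ¬ (CommutativeRing._≈_ F a (CommutativeRing.0# F)) →
    Poly.Indecomposable F (Poly.fa F (3 ^ (h + 1)) a)
lemma1 F isField zero    _    (s≤s (s≤s (s≤s ())))
lemma1 F isField (suc h) card 3<α a a≉0 =
  ∂-constant⇒indecomposable (fa α a) (fa-degree α a (ℕ.<-trans (s≤s (s≤s z≤n)) 3<α)) 9∤2α+3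
                            (-x*x≉0 a≉0) (∂-fa α a 3∣α)
  where
  open CommutativeRing F using (_≈_; 0#)
  open Poly F using (fa)
  open PolynomialsOverField F isField
  open Characteristic F using (fromℕ; cardinality⇒fromℕ≈0)

  3≈0 : fromℕ 3 ≈ 0#
  3≈0 = fromℕ-^≈0 3 (2 * suc h + 1) (cardinality⇒fromℕ≈0 card)

  open Characteristic3 3≈0

  α : ℕ
  α = 3 ^ (suc h + 1)

  3∣α : 3 ∣ α
  3∣α = m∣m*n (3 ^ (h + 1))

  9∣α : 9 ∣ α
  9∣α = *-pres-∣ (∣-refl {3}) (≡.subst (λ e → 3 ∣ 3 ^ e) (ℕ.+-comm 1 h) (m∣m*n (3 ^ h)))

  9∤2α+3 : ¬ 9 ∣ α + α + 3
  9∤2α+3 9∣2α+3 with ∣⇒≤ (∣m+n∣m⇒∣n 9∣2α+3 (∣m∣n⇒∣m+n 9∣α 9∣α))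
  ... | s≤s (s≤s (s≤s ()))
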